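{- Let $n\geq 5$ and let $\overrightarrow{G}$ be a nontrivial weakly connected spanning closed subgraph of $\overrightarrow{C_n^2}$. If $E(\overrightarrow{G})$ contains a frame, then $\overrightarrow{G}=\overrightarrow{S_{n,k,j}}$ for some integers $j,k$ with $0\leq j\leq n-1$ and $0\leq k\leq\lfloor\frac{n-2}{2}\rfloor$.
   Context: For $n\geq 5$, the directed square cycle $\overrightarrow{C_n^2}$ has vertex set $\mathbb{Z}_n$, writing $v_i=i+n\mathbb{Z}$ for $i\in\mathbb{Z}$ (indices modulo $n$), and edges $e_i=(v_i,v_{i+1})$ (frames) and $f_i=(v_i,v_{i+2})$ (windows), $i\in\mathbb{Z}$. A spanning subgraph has vertex set $\mathbb{Z}_n$ and a subset of the edges; it is weakly connected if its underlying undirected graph is connected. The triangle $T_i$ is $\{e_i,e_{i+1},f_i\}$; a subgraph $\overrightarrow{G}$ is closed if for every $i$, $|T_i\cap E(\overrightarrow{G})|\leq 1$ or $T_i\subseteq E(\overrightarrow{G})$. The trivial weakly connected spanning closed subgraphs are $\overrightarrow{C_n^2}$ itself and, when $n$ is odd, the subgraph whose edges are all the windows $f_0,\dots,f_{n-1}$; all others are nontrivial. For integers $j,k$ with $0\leq k\leq\lceil\frac{n-2}{2}\rceil$, $\overrightarrow{S_{n,k,j}}$ is the spanning subgraph of $\overrightarrow{C_n^2}$ with edge set $E(\overrightarrow{C_n^2})\setminus\big(\{f_{j-2},f_{j+2k-1}\}\cup\{e_{j-1},e_j,\dots,e_{j+2k-1}\}\big)$. -}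

module Defs where

open import Data.Nat using (ℕ; zero; suc; _+_; _*_; _∸_; _≤_; _<_; NonZero)
open import Data.Nat.DivMod using (_mod_)
open import Data.Fin using (Fin; toℕ)
open import Data.Bool using (Bool; true; false)
open import Data.Product using (Σ; _×_; _,_; ∃)
open import Data.Sum using (_⊎_)
open import Relation.Binary.PropositionalEquality using (_≡_)
open import Relation.Nullary using (¬_)
open import Function.Bundles using (_⇔_)

-- For n ≥ 5 the 2n edges e_i = (v_i, v_{i+1}) and f_i = (v_i, v_{i+2})
-- are pairwise distinct, so a spanning subgraph is exactly a choice of
-- which frames and which windows are present.
record Subgraph (n : ℕ) : Set where
  field
    frame  : Fin n → Bool   -- frame i ≡ true  iff  e_i ∈ E(G)
    window : Fin n → Bool   -- window i ≡ true iff  f_i ∈ E(G)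
open Subgraph public

idx : (n : ℕ) → .{{NonZero n}} → ℕ → Fin n
idx n i = i mod n

_⊕_ : {n : ℕ} → .{{NonZero n}} → Fin n → ℕ → Fin n
_⊕_ {n} i a = idx n (toℕ i + a)

data Adj {n : ℕ} .{{_ : NonZero n}} (G : Subgraph n) : Fin n → Fin n → Set where
  frame-fwd  : ∀ i → frame G i ≡ true  → Adj G i (i ⊕ 1)
  frame-bwd  : ∀ i → frame G i ≡ true  → Adj G (i ⊕ 1) i
  window-fwd : ∀ i → window G i ≡ true → Adj G i (i ⊕ 2)
  window-bwd : ∀ i → window G i ≡ true → Adj G (i ⊕ 2) i

data Reach {n : ℕ} .{{_ : NonZero n}} (G : Subgraph n) : Fin n → Fin n → Set where
  here : ∀ u → Reach G u u
  step : ∀ {u v w} → Adj G u v → Reach G v w → Reach G u w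

WeaklyConnected : {n : ℕ} → .{{NonZero n}} → Subgraph n → Set
WeaklyConnected G = ∀ u v → Reach G u v

b2n : Bool → ℕ
b2n true  = 1
b2n false = 0

Closed : {n : ℕ} → .{{NonZero n}} → Subgraph n → Set
Closed G = ∀ i →
  (b2n (frame G i) + b2n (frame G (i ⊕ 1)) + b2n (window G i) ≤ 1)
  ⊎ (frame G i ≡ true × frame G (i ⊕ 1) ≡ true × window G i ≡ true)

IsFull : {n : ℕ} → Subgraph n → Set
IsFull G = (∀ i → frame G i ≡ true) × (∀ i → window G i ≡ true)

IsAllWindows : {n : ℕ} → Subgraph n → Set
IsAllWindows G = (∀ i → frame G i ≡ false) × (∀ i → window G i ≡ true)

Odd : ℕ → Set
Odd n = Σ ℕ λ m → n ≡ suc (2 * m)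

Trivial : {n : ℕ} → Subgraph n → Set
Trivial {n} G = IsFull G ⊎ (Odd n × IsAllWindows G)

Nontrivial : {n : ℕ} → Subgraph n → Set
Nontrivial G = ¬ Trivial G

-- G = S_{n,k,j}: E(G) = E(C_n^2) \ ({f_{j-2}, f_{j+2k-1}} ∪ {e_{j-1},…,e_{j+2k-1}}).
-- Indices are taken mod n; j-1 is written j + (n-1), j-2 as j + (n-2),
-- and j+2k-1 as j + 2k + (n-1) (valid for n ≥ 5).
IsS : (n : ℕ) → .{{NonZero n}} → ℕ → ℕ → Subgraph n → Set
IsS n k j G =
  (∀ i → (frame G i ≡ false ⇔ (Σ ℕ λ t → t ≤ 2 * k × i ≡ idx n (j + (n ∸ 1) + t))))
  × (∀ i → (window G i ≡ false ⇔ (i ≡ idx n (j + (n ∸ 2)) ⊎ i ≡ idx n (j + 2 * k + (n ∸ 1)))))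

-- Read G from the first frame o of a run of absent frames, so that F m and W m are the frame
-- e_{o+m} and the window f_{o+m}.  Closedness makes W m present where F m and F (1 + m) are both
-- present and absent where exactly one of them is; only windows over two absent frames are free.
-- Everything rests on one separation principle (no-block): if the frames over [s − 1, p) and [q, t]
-- are absent, those over [p, q) present, and the windows entering s and leaving t absent, then the
-- vertices of [s, t] lying in [p, q] or sharing the parity of its nearer end form a nonempty proper
-- set that no edge leaves, contradicting weak connectivity.  With p = q this says that every run of
-- absent frames fenced by absent windows has odd length; so the first run has odd length 2k + 1, and
-- no free window inside it is missing, as that would split it into two fenced runs, one of even
-- length.  With [p, q] the present frames between the first run and a putative second one, it
-- rules out a second run.  What remains is exactly S_{n,k,o+1}.

module Submission where

open import Defs
open import Data.Nat using (ℕ; zero; suc; _+_; _*_; _∸_; _≤_; _<_; _%_; _/_; z≤n; s≤s; NonZero; _≤?_; _<?_)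
open import Data.Nat.Properties
open import Data.Nat.DivMod
open import Data.Fin using (Fin; toℕ)
open import Data.Fin.Properties using (toℕ-injective; toℕ-fromℕ<; toℕ<n; ¬∀⟶∃¬)
open import Data.Bool using (Bool; true; false; not; _∧_; if_then_else_)
open import Data.Bool.Properties using (∧-zeroʳ; ¬-not; not-involutive) renaming (_≟_ to _≟ᵇ_)
open import Data.Product using (Σ; _×_; _,_)
open import Data.Sum using (_⊎_; inj₁; inj₂)
open import Data.Empty using (⊥; ⊥-elim)
open import Function.Bundles using (mk⇔)
open import Relation.Nullary using (yes; no; does)
open import Relation.Nullary.Decidable using (dec-true; dec-false)
open import Relation.Binary.Definitions using (tri<; tri≈; tri>)
open import Relation.Binary.PropositionalEquality

even : ℕ → Bool
even zero          = true
even (suc zero)    = false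
even (suc (suc m)) = even m

even-suc : ∀ m → even (suc m) ≡ not (even m)
even-suc zero          = refl
even-suc (suc zero)    = refl
even-suc (suc (suc m)) = even-suc m

even-pred : ∀ a {b} → even (suc a) ≡ b → even a ≡ not b
even-pred a e = trans (sym (not-involutive (even a))) (cong not (trans (sym (even-suc a)) e))

even-double : ∀ m → even (m + m) ≡ true
even-double zero    = refl
even-double (suc m) = trans (cong (λ x → even (suc x)) (+-suc m m)) (even-double m)

even-+ : ∀ a b → even a ≡ true → even b ≡ true → even (a + b) ≡ true
even-+ zero          b _  eb = eb
even-+ (suc (suc a)) b ea eb = even-+ a b ea eb

even⇒double : ∀ m → even m ≡ true → Σ ℕ λ k → m ≡ 2 * k
even⇒double zero          _ = 0 , refl
even⇒double (suc (suc m)) e with even⇒double m e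
... | k , refl = suc k , cong suc (sym (+-suc k (k + 0)))

true≢false : true ≡ false → ⊥
true≢false ()

n<2+n : ∀ n → n < 2 + n
n<2+n n = m≤n⇒m≤1+n (n<1+n n)

2*k≤n⇒k≤n/2 : ∀ k n → 2 * k ≤ n → k ≤ n / 2
2*k≤n⇒k≤n/2 k n 2k≤n = subst (_≤ n / 2) (trans (cong (_/ 2) (*-comm 2 k)) (m*n/n≡m k 2)) (/-monoˡ-≤ 2 2k≤n)

data StepPosition (m x : ℕ) : Set where
  beyond : 2 + m < x → StepPosition m x
  onto₂  : 2 + m ≡ x → StepPosition m x
  onto₁  : 1 + m ≡ x → StepPosition m x
  behind : x ≤ m → StepPosition m x

stepPosition : ∀ m x → StepPosition m x
stepPosition m x with <-cmp (2 + m) x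
... | tri< lt _ _ = beyond lt
... | tri≈ _ eq _ = onto₂ eq
... | tri> _ _ (s≤s gt) with m≤n⇒m<n∨m≡n gt
...   | inj₁ (s≤s x≤m) = behind x≤m
...   | inj₂ eq        = onto₁ (sym eq)

record First (g : ℕ → Bool) (b : Bool) (lo hi : ℕ) : Set where
  field
    index    : ℕ
    lo≤index : lo ≤ index
    index≤hi : index ≤ hi
    hit      : g index ≡ b
    miss     : ∀ m → lo ≤ m → m < index → g m ≡ not b

first : ∀ g b {lo hi} → lo ≤ hi → g hi ≡ b → First g b lo hi
first g b {lo} lo≤hi found =
  subst (First g b lo) (m+[n∸m]≡n lo≤hi) (search lo _ (subst (λ x → g x ≡ b) (sym (m+[n∸m]≡n lo≤hi)) found))
  where
  search : ∀ lo k → g (lo + k) ≡ b → First g b lo (lo + k)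
  search lo k found with g lo ≟ᵇ b
  ... | yes hit = record
    { index = lo ; lo≤index = ≤-refl ; index≤hi = m≤m+n lo k ; hit = hit
    ; miss = λ m lo≤m m<lo → ⊥-elim (<⇒≱ m<lo lo≤m) }
  search lo zero    found | no missed = ⊥-elim (missed (subst (λ x → g x ≡ b) (+-identityʳ lo) found))
  search lo (suc k) found | no missed = record
    { index = index ; lo≤index = <⇒≤ lo<index ; index≤hi = subst (index ≤_) (sym (+-suc lo k)) index≤hi
    ; hit = hit ; miss = miss′ }
    where
    open First (search (suc lo) k (subst (λ x → g x ≡ b) (+-suc lo k) found))
      renaming (lo≤index to lo<index)
    miss′ : ∀ m → lo ≤ m → m < index → g m ≡ not b
    miss′ m lo≤m m<index with m≤n⇒m<n∨m≡n lo≤m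
    ... | inj₁ lo<m = miss m lo<m m<index
    ... | inj₂ refl = ¬-not missed

attached : ℕ → ℕ → ℕ → Bool
attached p q v = if does (v <? p) then even (v + p) else if does (v ≤? q) then true else even (v + q)

block : ℕ → ℕ → ℕ → ℕ → ℕ → Bool
block s p q t v = does (s ≤? v) ∧ does (v ≤? t) ∧ attached p q v

module _ (p q : ℕ) {v : ℕ} where

  attached-left : v < p → attached p q v ≡ even (v + p)
  attached-left v<p rewrite dec-true (v <? p) v<p = refl

  attached-core : p ≤ v → v ≤ q → attached p q v ≡ true
  attached-core p≤v v≤q rewrite dec-false (v <? p) (≤⇒≯ p≤v) | dec-true (v ≤? q) v≤q = refl

  attached-right : p ≤ v → q < v → attached p q v ≡ even (v + q)
  attached-right p≤v q<v rewrite dec-false (v <? p) (≤⇒≯ p≤v) | dec-false (v ≤? q) (<⇒≱ q<v) = refl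

module _ (s p q t : ℕ) {v : ℕ} where

  block-below : v < s → block s p q t v ≡ false
  block-below v<s rewrite dec-false (s ≤? v) (<⇒≱ v<s) = refl

  block-above : t < v → block s p q t v ≡ false
  block-above t<v rewrite dec-false (v ≤? t) (<⇒≱ t<v) = ∧-zeroʳ (does (s ≤? v))

  block-inside : s ≤ v → v ≤ t → block s p q t v ≡ attached p q v
  block-inside s≤v v≤t rewrite dec-true (s ≤? v) s≤v | dec-true (v ≤? t) v≤t = refl

attached-step₂ : ∀ {p q} m → p ≤ q → (1 + m ≡ p → p < q → ⊥) → (1 + m ≡ q → p ≤ m → ⊥) →
                 attached p q m ≡ attached p q (2 + m)
attached-step₂ {p} {q} m p≤q into-core out-of-core with stepPosition m p
... | beyond 2+m<p = trans (attached-left p q (<-trans (n<2+n m) 2+m<p)) (sym (attached-left p q 2+m<p))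
... | onto₂ refl   = trans (attached-left p q (n<2+n m))
                       (trans (trans (cong even (+-comm m (2 + m))) (even-double m)) (sym (attached-core p q ≤-refl p≤q)))
... | onto₁ refl with m≤n⇒m<n∨m≡n p≤q
...   | inj₁ p<q  = ⊥-elim (into-core refl p<q)
...   | inj₂ refl = trans (attached-left p q ≤-refl) (sym (attached-right p q (n≤1+n _) ≤-refl))
attached-step₂ {p} {q} m p≤q into-core out-of-core | behind p≤m with stepPosition m (suc q)
... | beyond 2+m<1+q = trans (attached-core p q p≤m (<⇒≤ (≤-pred (<-trans (n<1+n _) 2+m<1+q))))
                         (sym (attached-core p q (≤-trans p≤m (<⇒≤ (n<2+n m))) (≤-pred 2+m<1+q)))
... | onto₂ eq       = ⊥-elim (out-of-core (suc-injective eq) p≤m)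
... | onto₁ refl     = trans (attached-core p q p≤m ≤-refl)
                         (trans (sym (even-double m)) (sym (attached-right p q (≤-trans p≤m (<⇒≤ (n<2+n m))) (n<2+n m))))
... | behind 1+q≤m   = trans (attached-right p q p≤m 1+q≤m)
                         (sym (attached-right p q (≤-trans p≤m (<⇒≤ (n<2+n m))) (<-trans 1+q≤m (n<2+n m))))

block-step₂ : ∀ {s p q t} m → s ≤ p → p ≤ q → q ≤ t → even (s + p) ≡ true → even (t + q) ≡ true →
              (2 + m ≡ s → ⊥) → (m ≡ t → ⊥) → attached p q m ≡ attached p q (2 + m) →
              block s p q t m ≡ block s p q t (2 + m)
block-step₂ {s} {p} {q} {t} m s≤p p≤q q≤t s≡p t≡q enters leaves same-attached with stepPosition m s
... | beyond 2+m<s = trans (block-below s p q t (<-trans (n<2+n m) 2+m<s)) (sym (block-below s p q t 2+m<s))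
... | onto₂ eq     = ⊥-elim (enters eq)
... | onto₁ refl with 2 + m ≤? t
...   | no  2+m≰t = trans (block-below s p q t ≤-refl) (sym (block-above s p q t (≰⇒> 2+m≰t)))
...   | yes 2+m≤t = trans (block-below s p q t ≤-refl) (sym (begin
  block s p q t (2 + m)   ≡⟨ block-inside s p q t (n≤1+n _) 2+m≤t ⟩
  attached p q (2 + m)    ≡⟨ same-attached ⟨
  attached p q m          ≡⟨ attached-left p q s≤p ⟩
  even (m + p)            ≡⟨ even-pred (m + p) s≡p ⟩
  false                   ∎))
  where open ≡-Reasoning
block-step₂ {s} {p} {q} {t} m s≤p p≤q q≤t s≡p t≡q enters leaves same-attached | behind s≤m
  with stepPosition m (suc t)
... | beyond 2+m<1+t = trans (block-inside s p q t s≤m (<⇒≤ (≤-pred (<-trans (n<1+n _) 2+m<1+t))))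
                         (trans same-attached
                           (sym (block-inside s p q t (≤-trans s≤m (<⇒≤ (n<2+n m))) (≤-pred 2+m<1+t))))
... | onto₂ refl     = trans (begin
  block s p q t m         ≡⟨ block-inside s p q t s≤m (n≤1+n m) ⟩
  attached p q m          ≡⟨ same-attached ⟩
  attached p q (2 + m)    ≡⟨ attached-right p q (≤-trans p≤q (≤-trans q≤t (n≤1+n _))) (s≤s q≤t) ⟩
  even (2 + m + q)        ≡⟨ trans (even-suc (1 + m + q)) (cong not t≡q) ⟩
  false                   ∎) (sym (block-above s p q t ≤-refl))
  where open ≡-Reasoning
... | onto₁ eq       = ⊥-elim (leaves (suc-injective eq))
... | behind 1+t≤m   = trans (block-above s p q t 1+t≤m) (sym (block-above s p q t (<-trans 1+t≤m (n<2+n m))))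

block-step₁ : ∀ {s p q t} m → s ≤ p → p ≤ q → q ≤ t →
              (s ≤ 1 + m → m < p → ⊥) → (q ≤ m → m ≤ t → ⊥) →
              block s p q t m ≡ block s p q t (1 + m)
block-step₁ {s} {p} {q} {t} m s≤p p≤q q≤t left-gap right-gap with <-≤-connex (1 + m) s
... | inj₁ 1+m<s = trans (block-below s p q t (<-trans (n<1+n m) 1+m<s)) (sym (block-below s p q t 1+m<s))
... | inj₂ s≤1+m with <-≤-connex m p
...   | inj₁ m<p = ⊥-elim (left-gap s≤1+m m<p)
...   | inj₂ p≤m with <-≤-connex m q
...     | inj₁ m<q = trans (block-inside s p q t (≤-trans s≤p p≤m) (≤-trans (<⇒≤ m<q) q≤t))
                       (trans (attached-core p q p≤m (<⇒≤ m<q))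
                       (sym (trans (block-inside s p q t s≤1+m (≤-trans m<q q≤t))
                                   (attached-core p q (m≤n⇒m≤1+n p≤m) m<q))))
...     | inj₂ q≤m with <-≤-connex t m
...       | inj₁ t<m = trans (block-above s p q t t<m) (sym (block-above s p q t (m<n⇒m<1+n t<m)))
...       | inj₂ m≤t = ⊥-elim (right-gap q≤m m≤t)

Triangle : Bool → Bool → Bool → Set
Triangle x y z = (b2n x + b2n y + b2n z ≤ 1) ⊎ (x ≡ true × y ≡ true × z ≡ true)

triangle-rise : ∀ {z} → Triangle false true z → z ≡ false
triangle-rise {false} _                   = refl
triangle-rise {true}  (inj₁ (s≤s ()))
triangle-rise {true}  (inj₂ (() , _))

triangle-fall : ∀ {z} → Triangle true false z → z ≡ false
triangle-fall {false} _                   = refl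
triangle-fall {true}  (inj₁ (s≤s ()))
triangle-fall {true}  (inj₂ (_ , () , _))

triangle-full : ∀ {z} → Triangle true true z → z ≡ true
triangle-full {true}  _                   = refl
triangle-full {false} (inj₁ (s≤s ()))
triangle-full {false} (inj₂ (_ , _ , ()))

module Cyclic (N : ℕ) where

  n : ℕ
  n = suc (suc N)

  toℕ-idx : ∀ x → toℕ (idx n x) ≡ x % n
  toℕ-idx x = toℕ-fromℕ< (m%n<n x n)

  idx-cong-% : ∀ x y → x % n ≡ y % n → idx n x ≡ idx n y
  idx-cong-% x y eq = toℕ-injective (trans (toℕ-idx x) (trans eq (sym (toℕ-idx y))))

  [m%n+k]%n≡[m+k]%n : ∀ m k → (m % n + k) % n ≡ (m + k) % n
  [m%n+k]%n≡[m+k]%n m k = begin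
    (m % n + k) % n         ≡⟨ %-distribˡ-+ (m % n) k n ⟩
    (m % n % n + k % n) % n ≡⟨ cong (λ x → (x + k % n) % n) (m%n%n≡m%n m n) ⟩
    (m % n + k % n) % n     ≡⟨ %-distribˡ-+ m k n ⟨
    (m + k) % n             ∎
    where open ≡-Reasoning

  [k+m%n]%n≡[k+m]%n : ∀ k m → (k + m % n) % n ≡ (k + m) % n
  [k+m%n]%n≡[k+m]%n k m =
    trans (cong (_% n) (+-comm k (m % n))) (trans ([m%n+k]%n≡[m+k]%n m k) (cong (_% n) (+-comm m k)))

  ⊕-assoc : ∀ (o : Fin n) a b → (o ⊕ a) ⊕ b ≡ o ⊕ (a + b)
  ⊕-assoc o a b = idx-cong-% (toℕ (o ⊕ a) + b) (toℕ o + (a + b)) (begin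
    (toℕ (o ⊕ a) + b) % n   ≡⟨ cong (λ x → (x + b) % n) (toℕ-idx (toℕ o + a)) ⟩
    ((toℕ o + a) % n + b) % n ≡⟨ [m%n+k]%n≡[m+k]%n (toℕ o + a) b ⟩
    (toℕ o + a + b) % n     ≡⟨ cong (_% n) (+-assoc (toℕ o) a b) ⟩
    (toℕ o + (a + b)) % n   ∎)
    where open ≡-Reasoning

  ⊕-periodic : ∀ (o : Fin n) m → o ⊕ (m + n) ≡ o ⊕ m
  ⊕-periodic o m = idx-cong-% (toℕ o + (m + n)) (toℕ o + m)
    (trans (cong (_% n) (sym (+-assoc (toℕ o) m n))) ([m+n]%n≡m%n (toℕ o + m) n))

  offset : Fin n → Fin n → ℕ
  offset o v = (toℕ v + (n ∸ toℕ o)) % n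

  offset<n : ∀ o v → offset o v < n
  offset<n o v = m%n<n (toℕ v + (n ∸ toℕ o)) n

  +-cancel-∸ : ∀ (o : Fin n) m → toℕ o + m + (n ∸ toℕ o) ≡ m + n
  +-cancel-∸ o m = begin
    toℕ o + m + (n ∸ toℕ o)   ≡⟨ cong (_+ (n ∸ toℕ o)) (+-comm (toℕ o) m) ⟩
    m + toℕ o + (n ∸ toℕ o)   ≡⟨ +-assoc m (toℕ o) (n ∸ toℕ o) ⟩
    m + (toℕ o + (n ∸ toℕ o)) ≡⟨ cong (m +_) (m+[n∸m]≡n (<⇒≤ (toℕ<n o))) ⟩
    m + n                     ∎
    where open ≡-Reasoning

  ⊕-offset : ∀ o v → o ⊕ offset o v ≡ v
  ⊕-offset o v = toℕ-injective (begin
    toℕ (o ⊕ offset o v)                 ≡⟨ toℕ-idx (toℕ o + offset o v) ⟩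
    (toℕ o + offset o v) % n              ≡⟨ [k+m%n]%n≡[k+m]%n (toℕ o) _ ⟩
    (toℕ o + (toℕ v + (n ∸ toℕ o))) % n   ≡⟨ cong (_% n) (sym (+-assoc (toℕ o) (toℕ v) _)) ⟩
    (toℕ o + toℕ v + (n ∸ toℕ o)) % n     ≡⟨ cong (_% n) (+-cancel-∸ o (toℕ v)) ⟩
    (toℕ v + n) % n                       ≡⟨ [m+n]%n≡m%n (toℕ v) n ⟩
    toℕ v % n                             ≡⟨ m<n⇒m%n≡m (toℕ<n v) ⟩
    toℕ v                                 ∎)
    where open ≡-Reasoning

  offset-⊕ : ∀ o m → offset o (o ⊕ m) ≡ m % n
  offset-⊕ o m = begin
    (toℕ (o ⊕ m) + (n ∸ toℕ o)) % n       ≡⟨ cong (λ x → (x + (n ∸ toℕ o)) % n) (toℕ-idx (toℕ o + m)) ⟩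
    ((toℕ o + m) % n + (n ∸ toℕ o)) % n   ≡⟨ [m%n+k]%n≡[m+k]%n (toℕ o + m) _ ⟩
    (toℕ o + m + (n ∸ toℕ o)) % n         ≡⟨ cong (_% n) (+-cancel-∸ o m) ⟩
    (m + n) % n                           ≡⟨ [m+n]%n≡m%n m n ⟩
    m % n                                 ∎
    where open ≡-Reasoning

  offset-step : ∀ o v k → offset o (v ⊕ k) ≡ (k + offset o v) % n
  offset-step o v k = begin
    offset o (v ⊕ k)                    ≡⟨ cong (λ x → offset o (x ⊕ k)) (⊕-offset o v) ⟨
    offset o ((o ⊕ offset o v) ⊕ k)     ≡⟨ cong (offset o) (⊕-assoc o (offset o v) k) ⟩
    offset o (o ⊕ (offset o v + k))     ≡⟨ offset-⊕ o _ ⟩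
    (offset o v + k) % n                ≡⟨ cong (_% n) (+-comm (offset o v) k) ⟩
    (k + offset o v) % n                ∎
    where open ≡-Reasoning

  idx-after-successor : ∀ o a → idx n (toℕ (o ⊕ 1) + (suc N + a)) ≡ o ⊕ a
  idx-after-successor o a = begin
    (o ⊕ 1) ⊕ (suc N + a)   ≡⟨ ⊕-assoc o 1 (suc N + a) ⟩
    o ⊕ (n + a)             ≡⟨ cong (o ⊕_) (+-comm n a) ⟩
    o ⊕ (a + n)             ≡⟨ ⊕-periodic o a ⟩
    o ⊕ a                   ∎
    where open ≡-Reasoning

  ⊕-identityʳ : ∀ o → o ⊕ 0 ≡ o
  ⊕-identityʳ o = toℕ-injective (begin
    toℕ (o ⊕ 0)        ≡⟨ toℕ-idx (toℕ o + 0) ⟩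
    (toℕ o + 0) % n    ≡⟨ cong (_% n) (+-identityʳ (toℕ o)) ⟩
    toℕ o % n          ≡⟨ m<n⇒m%n≡m (toℕ<n o) ⟩
    toℕ o              ∎)
    where open ≡-Reasoning

module AtOrigin {N : ℕ} (G : Subgraph (suc (suc N))) (closed : Closed G) (connected : WeaklyConnected G)
                (o : Fin (suc (suc N))) where
  open Cyclic N

  F W : ℕ → Bool
  F m = frame G (o ⊕ m)
  W m = window G (o ⊕ m)

  F-periodic : ∀ m → F (m + n) ≡ F m
  F-periodic m = cong (frame G) (⊕-periodic o m)

  W-periodic : ∀ m → W (m + n) ≡ W m
  W-periodic m = cong (window G) (⊕-periodic o m)

  frame-at : ∀ v → frame G v ≡ F (offset o v)
  frame-at v = cong (frame G) (sym (⊕-offset o v))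

  window-at : ∀ v → window G v ≡ W (offset o v)
  window-at v = cong (window G) (sym (⊕-offset o v))

  triangle : ∀ m → Triangle (F m) (F (1 + m)) (W m)
  triangle m = subst (λ v → Triangle (F m) (frame G v) (W m))
                 (trans (⊕-assoc o m 1) (cong (o ⊕_) (+-comm m 1))) (closed (o ⊕ m))

  window-absent-at-rise : ∀ {m} → F m ≡ false → F (1 + m) ≡ true → W m ≡ false
  window-absent-at-rise {m} before after = triangle-rise (subst₂ (λ x y → Triangle x y (W m)) before after (triangle m))

  window-absent-at-fall : ∀ {m} → F m ≡ true → F (1 + m) ≡ false → W m ≡ false
  window-absent-at-fall {m} before after = triangle-fall (subst₂ (λ x y → Triangle x y (W m)) before after (triangle m))

  window-present-inside : ∀ {m} → F m ≡ true → F (1 + m) ≡ true → W m ≡ true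
  window-present-inside {m} before after = triangle-full (subst₂ (λ x y → Triangle x y (W m)) before after (triangle m))

  record Invariant (S : ℕ → Bool) : Set where
    field
      frame-step         : ∀ m → 1 + m < n → F m ≡ true → S m ≡ S (1 + m)
      last-frame-step    : F (suc N) ≡ true → S (suc N) ≡ S 0
      window-step        : ∀ m → 2 + m < n → W m ≡ true → S m ≡ S (2 + m)
      window-step-into-0 : W N ≡ true → S N ≡ S 0
      window-step-into-1 : W (suc N) ≡ true → S (suc N) ≡ S 1

  invariant-constant : ∀ {S} → Invariant S → ∀ m → m < n → S m ≡ S 0
  invariant-constant {S} inv m m<n = begin
    S m                  ≡⟨ cong S (trans (sym (m<n⇒m%n≡m m<n)) (sym (offset-⊕ o m))) ⟩
    label (o ⊕ m)        ≡⟨ label-reach (connected (o ⊕ m) (o ⊕ 0)) ⟩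
    label (o ⊕ 0)        ≡⟨ cong S (offset-⊕ o 0) ⟩
    S 0                  ∎
    where
    open ≡-Reasoning
    open Invariant inv

    cyclic-frame-step : ∀ m → m < n → F m ≡ true → S m ≡ S ((1 + m) % n)
    cyclic-frame-step m (s≤s m≤1+N) present with m≤n⇒m<n∨m≡n m≤1+N
    ... | inj₁ m<1+N = trans (frame-step m (s≤s m<1+N) present) (cong S (sym (m<n⇒m%n≡m (s≤s m<1+N))))
    ... | inj₂ refl  = trans (last-frame-step present) (cong S (sym (n%n≡0 n)))

    cyclic-window-step : ∀ m → m < n → W m ≡ true → S m ≡ S ((2 + m) % n)
    cyclic-window-step m (s≤s m≤1+N) present with m≤n⇒m<n∨m≡n m≤1+N
    ... | inj₂ refl = trans (window-step-into-1 present)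
                        (cong S (sym ([m+n]%n≡m%n 1 n)))
    ... | inj₁ (s≤s m≤N) with m≤n⇒m<n∨m≡n m≤N
    ...   | inj₁ m<N = trans (window-step m (s≤s (s≤s m<N)) present) (cong S (sym (m<n⇒m%n≡m (s≤s (s≤s m<N)))))
    ...   | inj₂ refl = trans (window-step-into-0 present) (cong S (sym (n%n≡0 n)))

    label : Fin n → Bool
    label v = S (offset o v)

    label-adj : ∀ {u v} → Adj G u v → label u ≡ label v
    label-adj (frame-fwd i p)  = trans (cyclic-frame-step _ (offset<n o i) (trans (sym (frame-at i)) p))
                                   (cong S (sym (offset-step o i 1)))
    label-adj (frame-bwd i p)  = sym (label-adj (frame-fwd i p))
    label-adj (window-fwd i p) = trans (cyclic-window-step _ (offset<n o i) (trans (sym (window-at i)) p))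
                                   (cong S (sym (offset-step o i 2)))
    label-adj (window-bwd i p) = sym (label-adj (window-fwd i p))

    label-reach : ∀ {u v} → Reach G u v → label u ≡ label v
    label-reach (here u)   = refl
    label-reach (step e r) = trans (label-adj e) (label-reach r)

  record Block (s p q t : ℕ) : Set where
    field
      0<s      : 0 < s
      s≤p      : s ≤ p
      p≤q      : p ≤ q
      q≤t      : q ≤ t
      t≤N      : t ≤ N
      s+p-even : even (s + p) ≡ true
      t+q-even : even (t + q) ≡ true
      left-frames-absent  : ∀ m → s ≤ 1 + m → m < p → F m ≡ false
      core-frames-present : ∀ m → p ≤ m → m < q → F m ≡ true
      right-frames-absent : ∀ m → q ≤ m → m ≤ t → F m ≡ false
      -- W (s + N) is the window f_{s−2} entering s, read cyclically.
      entry-window-absent : W (s + N) ≡ false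
      exit-window-absent  : W t ≡ false

  block-invariant : ∀ {s p q t} → Block s p q t → Invariant (block s p q t)
  block-invariant {s} {p} {q} {t} B = record
    { frame-step         = λ m _ present → block-step₁ m s≤p p≤q q≤t
                             (λ s≤1+m m<p → true≢false (trans (sym present) (left-frames-absent m s≤1+m m<p)))
                             (λ q≤m m≤t → true≢false (trans (sym present) (right-frames-absent m q≤m m≤t)))
    ; last-frame-step    = λ _ → trans (block-above s p q t (s≤s t≤N)) (sym (block-below s p q t 0<s))
    ; window-step        = λ m _ present → window-step m (λ absent → true≢false (trans (sym present) absent))
    ; window-step-into-0 = λ present → into-0 (λ absent → true≢false (trans (sym present) absent))
    ; window-step-into-1 = λ present → into-1 (λ absent → true≢false (trans (sym present) absent))
    }
    where
    open Block B

    window-step : ∀ m → (W m ≡ false → ⊥) → block s p q t m ≡ block s p q t (2 + m)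
    window-step m present = block-step₂ m s≤p p≤q q≤t s+p-even t+q-even enters leaves
                              (attached-step₂ m p≤q into-core out-of-core)
      where
      enters : 2 + m ≡ s → ⊥
      enters refl = present (trans (sym (W-periodic m))
                      (trans (cong W (trans (+-suc m (suc N)) (cong suc (+-suc m N)))) entry-window-absent))
      leaves : m ≡ t → ⊥
      leaves refl = present exit-window-absent
      into-core : 1 + m ≡ p → p < q → ⊥
      into-core refl p<q = present (window-absent-at-rise (left-frames-absent m s≤p ≤-refl)
                                                          (core-frames-present (1 + m) ≤-refl p<q))
      out-of-core : 1 + m ≡ q → p ≤ m → ⊥
      out-of-core refl p≤m = present (window-absent-at-fall (core-frames-present m p≤m ≤-refl)
                                                            (right-frames-absent (1 + m) ≤-refl q≤t))

    into-0 : (W N ≡ false → ⊥) → block s p q t N ≡ block s p q t 0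
    into-0 present with m≤n⇒m<n∨m≡n t≤N
    ... | inj₁ t<N  = trans (block-above s p q t t<N) (sym (block-below s p q t 0<s))
    ... | inj₂ refl = ⊥-elim (present exit-window-absent)

    into-1 : (W (suc N) ≡ false → ⊥) → block s p q t (suc N) ≡ block s p q t 1
    into-1 present with m≤n⇒m<n∨m≡n 0<s
    ... | inj₁ 1<s  = trans (block-above s p q t (s≤s t≤N)) (sym (block-below s p q t 1<s))
    ... | inj₂ refl = ⊥-elim (present entry-window-absent)

  no-block : ∀ {s p q t} → Block s p q t → ⊥
  no-block {s} {p} {q} {t} B = true≢false (begin
    true             ≡⟨ attached-core p q ≤-refl p≤q ⟨
    attached p q p   ≡⟨ block-inside s p q t s≤p (≤-trans p≤q q≤t) ⟨
    block s p q t p  ≡⟨ invariant-constant (block-invariant B) p p<n ⟩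
    block s p q t 0  ≡⟨ block-below s p q t 0<s ⟩
    false            ∎)
    where
    open ≡-Reasoning
    open Block B
    p<n : p < n
    p<n = s≤s (m≤n⇒m≤1+n (≤-trans p≤q (≤-trans q≤t t≤N)))

  -- The run [c, e] has odd length; W (c + suc N) is the window f_{c−1}, read cyclically.
  run-length-odd : ∀ {c e} → c ≤ e → e ≤ N → (∀ m → c ≤ m → m ≤ e → F m ≡ false) →
                   W (c + suc N) ≡ false → W e ≡ false → even (e + c) ≡ true
  run-length-odd {c} {e} c≤e e≤N absent entry exit with even (e + c) in parity
  ... | true  = refl
  ... | false = ⊥-elim (no-block {1 + c} {1 + c} {1 + c} {e} record
    { 0<s = s≤s z≤n ; s≤p = ≤-refl ; p≤q = ≤-refl ; q≤t = c<e ; t≤N = e≤N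
    ; s+p-even = even-double (1 + c)
    ; t+q-even = trans (cong even (+-suc e c)) (trans (even-suc (e + c)) (cong not parity))
    ; left-frames-absent  = λ m 1+c≤1+m m<1+c → absent m (≤-pred 1+c≤1+m) (≤-trans (≤-pred m<1+c) c≤e)
    ; core-frames-present = λ m 1+c≤m m<1+c → ⊥-elim (<⇒≱ m<1+c 1+c≤m)
    ; right-frames-absent = λ m 1+c≤m m≤e → absent m (<⇒≤ 1+c≤m) m≤e
    ; entry-window-absent = trans (cong W (sym (+-suc c N))) entry
    ; exit-window-absent  = exit
    })
    where
    c<e : c < e
    c<e = ≤∧≢⇒< c≤e (λ { refl → true≢false (trans (sym (even-double c)) parity) })

  record FirstRun : Set where
    field
      ℓ              : ℕ
      ℓ≤N            : ℓ ≤ N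
      absent-until   : ∀ m → m ≤ ℓ → F m ≡ false
      present-after  : F (1 + ℓ) ≡ true

  first-run : F 0 ≡ false → F (suc N) ≡ true → FirstRun
  first-run start end with first F true z≤n end
  ... | record { index = zero ; hit = hit } = ⊥-elim (true≢false (trans (sym hit) start))
  ... | record { index = suc ℓ ; index≤hi = s≤s ℓ≤N ; hit = hit ; miss = miss } =
        record { ℓ = ℓ ; ℓ≤N = ℓ≤N ; present-after = hit
               ; absent-until = λ m m≤ℓ → miss m z≤n (s≤s m≤ℓ) }

  module StartOfRun (start : F 0 ≡ false) (end : F (suc N) ≡ true) where
    open FirstRun (first-run start end) public

    last-window-absent : W (suc N) ≡ false
    last-window-absent = window-absent-at-fall end (trans (F-periodic 0) start)

    exit-window-absent : W ℓ ≡ false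
    exit-window-absent = window-absent-at-rise (absent-until ℓ ≤-refl) present-after

    ℓ-even : even ℓ ≡ true
    ℓ-even = trans (cong even (sym (+-identityʳ ℓ)))
               (run-length-odd z≤n ℓ≤N (λ m _ → absent-until m) last-window-absent exit-window-absent)

    windows-present-within : ∀ m → m < ℓ → W m ≡ true
    windows-present-within m m<ℓ with W m in absent | even m in parity
    ... | true  | _     = refl
    ... | false | true  = ⊥-elim (true≢false (begin
      true                ≡⟨ run-length-odd m<ℓ ℓ≤N (λ k _ k≤ℓ → absent-until k k≤ℓ) entry exit-window-absent ⟨
      even (ℓ + (1 + m))  ≡⟨ cong even (+-suc ℓ m) ⟩
      even (1 + (ℓ + m))  ≡⟨ even-suc (ℓ + m) ⟩
      not (even (ℓ + m))  ≡⟨ cong not (even-+ ℓ m ℓ-even parity) ⟩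
      false               ∎))
      where
      open ≡-Reasoning
      entry : W (1 + m + suc N) ≡ false
      entry = trans (cong W (sym (+-suc m (suc N)))) (trans (W-periodic m) absent)
    ... | false | false = ⊥-elim (true≢false (begin
      true                ≡⟨ run-length-odd z≤n (≤-trans (<⇒≤ m<ℓ) ℓ≤N)
                               (λ k _ k≤m → absent-until k (≤-trans k≤m (<⇒≤ m<ℓ))) last-window-absent absent ⟨
      even (m + 0)        ≡⟨ cong even (+-identityʳ m) ⟩
      even m              ≡⟨ parity ⟩
      false               ∎))
      where open ≡-Reasoning

    no-second-run : ∀ {c e} → 1 + ℓ < c → c ≤ e → e ≤ N →
                    (∀ m → 1 + ℓ ≤ m → m < c → F m ≡ true) → (∀ m → c ≤ m → m ≤ e → F m ≡ false) →
                    F (1 + e) ≡ true → ⊥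
    no-second-run {suc c} {e} 1+ℓ<1+c 1+c≤e e≤N present absent e-exit = no-block {1} {1 + ℓ} {1 + c} {e} record
      { 0<s = s≤s z≤n ; s≤p = s≤s z≤n ; p≤q = <⇒≤ 1+ℓ<1+c ; q≤t = 1+c≤e ; t≤N = e≤N
      ; s+p-even = ℓ-even
      ; t+q-even = run-length-odd 1+c≤e e≤N absent entry exit
      ; left-frames-absent  = λ m _ m<1+ℓ → absent-until m (≤-pred m<1+ℓ)
      ; core-frames-present = present
      ; right-frames-absent = absent
      ; entry-window-absent = last-window-absent
      ; exit-window-absent  = exit
      }
      where
      exit : W e ≡ false
      exit = window-absent-at-rise (absent e 1+c≤e ≤-refl) e-exit
      entry : W (1 + c + suc N) ≡ false
      entry = trans (cong W (sym (+-suc c (suc N)))) (trans (W-periodic c)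
                (window-absent-at-fall (present c (≤-pred 1+ℓ<1+c) ≤-refl) (absent (1 + c) ≤-refl 1+c≤e)))

    frames-present-after : ∀ m → 1 + ℓ ≤ m → m ≤ suc N → F m ≡ true
    frames-present-after m 1+ℓ≤m m≤1+N with F m in m-absent
    ... | true  = refl
    ... | false with first F false 1+ℓ≤m m-absent
    ...   | record { index = c ; lo≤index = 1+ℓ≤c ; index≤hi = c≤m ; hit = c-absent ; miss = present }
          with first F true (≤-trans c≤m m≤1+N) end
    ...     | record { index = zero ; lo≤index = c≤0 } = ⊥-elim (<⇒≱ (≤-trans (s≤s z≤n) 1+ℓ≤c) c≤0)
    ...     | record { index = suc e ; lo≤index = c≤1+e ; index≤hi = s≤s e≤N ; hit = e-exit ; miss = absent } =
              ⊥-elim (no-second-run 1+ℓ<c c≤e e≤N present (λ k c≤k k≤e → absent k c≤k (s≤s k≤e)) e-exit)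
      where
      1+ℓ<c : 1 + ℓ < c
      1+ℓ<c = ≤∧≢⇒< 1+ℓ≤c (λ { refl → true≢false (trans (sym present-after) c-absent) })
      c≤e : c ≤ e
      c≤e = ≤-pred (≤∧≢⇒< c≤1+e (λ { refl → true≢false (trans (sym e-exit) c-absent) }))

    frame-absent-within : ∀ m → m < n → F m ≡ false → m ≤ ℓ
    frame-absent-within m (s≤s m≤1+N) absent with m ≤? ℓ
    ... | yes m≤ℓ = m≤ℓ
    ... | no  m≰ℓ = ⊥-elim (true≢false (trans (sym (frames-present-after m (≰⇒> m≰ℓ) m≤1+N)) absent))

    window-absent-only : ∀ m → m < n → W m ≡ false → m ≡ ℓ ⊎ m ≡ suc N
    window-absent-only m (s≤s m≤1+N) absent with <-cmp m ℓ
    ... | tri< m<ℓ _ _ = ⊥-elim (true≢false (trans (sym (windows-present-within m m<ℓ)) absent))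
    ... | tri≈ _ m≡ℓ _ = inj₁ m≡ℓ
    ... | tri> _ _ ℓ<m with m≤n⇒m<n∨m≡n m≤1+N
    ...   | inj₂ m≡1+N = inj₂ m≡1+N
    ...   | inj₁ m<1+N = ⊥-elim (true≢false (trans (sym (window-present-inside
              (frames-present-after m ℓ<m (<⇒≤ m<1+N))
              (frames-present-after (1 + m) (m≤n⇒m≤1+n ℓ<m) m<1+N))) absent))

    is-S : Σ ℕ λ j → Σ ℕ λ k → j < n × k ≤ N / 2 × IsS n k j G
    is-S with even⇒double ℓ ℓ-even
    ... | k , ℓ≡2k = j , k , toℕ<n (o ⊕ 1) , 2*k≤n⇒k≤n/2 k N (subst (_≤ N) ℓ≡2k ℓ≤N)
                   , (λ i → mk⇔ (frame-to i) (frame-from i))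
                   , (λ i → mk⇔ (window-to i) (window-from i))
      where
      j : ℕ
      j = toℕ (o ⊕ 1)

      frame-index : ∀ t → idx n (j + suc N + t) ≡ o ⊕ t
      frame-index t = trans (cong (idx n) (+-assoc j (suc N) t)) (idx-after-successor o t)

      frame-to : ∀ i → frame G i ≡ false → Σ ℕ λ t → t ≤ 2 * k × i ≡ idx n (j + suc N + t)
      frame-to i absent = offset o i
                        , subst (offset o i ≤_) ℓ≡2k
                            (frame-absent-within _ (offset<n o i) (trans (sym (frame-at i)) absent))
                        , trans (sym (⊕-offset o i)) (sym (frame-index (offset o i)))

      frame-from : ∀ i → (Σ ℕ λ t → t ≤ 2 * k × i ≡ idx n (j + suc N + t)) → frame G i ≡ false
      frame-from i (t , t≤2k , i≡) =
        trans (cong (frame G) (trans i≡ (frame-index t))) (absent-until t (subst (t ≤_) (sym ℓ≡2k) t≤2k))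

      exit-index : idx n (j + 2 * k + suc N) ≡ o ⊕ ℓ
      exit-index = trans (cong (idx n) (trans (+-assoc j (2 * k) (suc N)) (cong (j +_) (+-comm (2 * k) (suc N)))))
                     (trans (idx-after-successor o (2 * k)) (cong (o ⊕_) (sym ℓ≡2k)))

      window-to : ∀ i → window G i ≡ false → i ≡ idx n (j + N) ⊎ i ≡ idx n (j + 2 * k + suc N)
      window-to i absent with window-absent-only _ (offset<n o i) (trans (sym (window-at i)) absent)
      ... | inj₁ at-exit = inj₂ (trans (sym (⊕-offset o i)) (trans (cong (o ⊕_) at-exit) (sym exit-index)))
      ... | inj₂ at-last = inj₁ (trans (sym (⊕-offset o i)) (trans (cong (o ⊕_) at-last) (sym (⊕-assoc o 1 N))))

      window-from : ∀ i → i ≡ idx n (j + N) ⊎ i ≡ idx n (j + 2 * k + suc N) → window G i ≡ false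
      window-from i (inj₁ i≡) = trans (cong (window G) (trans i≡ (⊕-assoc o 1 N))) last-window-absent
      window-from i (inj₂ i≡) = trans (cong (window G) (trans i≡ exit-index)) exit-window-absent

module _ {N : ℕ} (G : Subgraph (suc (suc N))) where
  open Cyclic N

  some-frame-absent : Closed G → Nontrivial G → Σ (Fin n) λ q → frame G q ≡ false
  some-frame-absent closed nontrivial
    with ¬∀⟶∃¬ n (λ i → frame G i ≡ true) (λ i → frame G i ≟ᵇ true) not-all-present
    where
    not-all-present : (∀ i → frame G i ≡ true) → ⊥
    not-all-present present = nontrivial (inj₁ (present , λ i →
      triangle-full (subst₂ (λ x y → Triangle x y (window G i)) (present i) (present (i ⊕ 1)) (closed i))))
  ... | q , q-absent = q , ¬-not q-absent

  run-start : (p q : Fin n) → frame G p ≡ true → frame G q ≡ false →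
              Σ (Fin n) λ o → frame G (o ⊕ 0) ≡ false × frame G (o ⊕ suc N) ≡ true
  run-start p q p-present q-absent
    with first (λ m → frame G (p ⊕ m)) false z≤n (trans (cong (frame G) (⊕-offset p q)) q-absent)
  ... | record { index = zero ; hit = p-absent } =
        ⊥-elim (true≢false (trans (sym p-present) (trans (cong (frame G) (sym (⊕-identityʳ p))) p-absent)))
  ... | record { index = suc a ; hit = absent ; miss = present } =
        p ⊕ suc a
      , trans (cong (frame G) (trans (⊕-assoc p (suc a) 0) (cong (p ⊕_) (+-identityʳ (suc a))))) absent
      , trans (cong (frame G) (trans (⊕-assoc p (suc a) (suc N))
                (trans (cong (p ⊕_) (sym (+-suc a (suc N)))) (⊕-periodic p a))))
              (present a z≤n ≤-refl)

lemma3p3 : (n : ℕ) → .{{_ : NonZero n}} → 5 ≤ n → (G : Subgraph n) →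
    Nontrivial G → WeaklyConnected G → Closed G →
    (Σ (Fin n) λ i → frame G i ≡ true) →
    Σ ℕ λ j → Σ ℕ λ k → j < n × k ≤ (n ∸ 2) / 2 × IsS n k j G
-- n ≥ 5 only makes the 2n edges distinct, which the encoding by Subgraph already presupposes.
lemma3p3 (suc (suc N)) (s≤s (s≤s _)) G nontrivial connected closed (p , p-present) =
  let q , q-absent     = some-frame-absent G closed nontrivial
      o , start , end  = run-start G p q p-present q-absent
  in  AtOrigin.StartOfRun.is-S G closed connected o start end
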